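{- Let $\mathcal{C}$ be a clutter with vertex set $X=\{x_1,\dots,x_n\}$ and minimal vertex covers $D_1,\dots,D_t$, and suppose $H_1,\dots,H_t$ is a shelling of $\Delta_{\mathcal{C}}$ with $H_i=X\setminus D_i$. Let $A\subset X$ and let $I'=\bigcap_{i:\,D_i\cap A=\emptyset}(D_i)\subset k[x_1,\dots,x_n]$, where $(D_i)$ denotes the ideal generated by the variables in $D_i$. Then the Stanley–Reisner complex $\Delta_{I'}$ is shellable, and a shelling is given by the subsequence of $H_1,\dots,H_t$ consisting of those $H_i$ with $D_i\cap A=\emptyset$ (in the induced order).
   Context: A clutter on $X$ is a family of subsets of $X$ (edges) none contained in another; a vertex cover is a subset of $X$ meeting every edge, and it is minimal if no proper subset is a vertex cover. $\Delta_{\mathcal{C}}$ is the Stanley–Reisner complex on $X$ of the edge ideal $I(\mathcal{C})$ (generated by the squarefree monomials $\prod_{x\in S}x$, $S$ an edge); its facets are exactly the sets $X\setminus D_i$. A simplicial complex is shellable if its facets can be ordered $F_1,\dots,F_s$ so that for all $1\le i<j\le s$ there exist $v\in F_j\setminus F_i$ and $\ell\in\{1,\dots,j-1\}$ with $F_j\setminus F_\ell=\{v\}$ (non-pure shellability); such an ordering is a shelling. -}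

module Defs where

open import Data.Nat using (ℕ; _<_)
open import Data.Fin using (Fin; toℕ)
open import Data.Fin.Subset using (Subset; _∈_; _∉_; _⊆_; _∩_; _─_; ∁; ⁅_⁆; Nonempty; Empty)
open import Data.Fin.Subset.Properties using (nonempty?)
open import Data.List using (List; length; lookup; filter; map)
open import Data.List.Membership.Propositional using () renaming (_∈_ to _∈ₗ_)
open import Data.List.Relation.Unary.All using (All)
open import Data.List.Relation.Unary.Unique.Propositional using (Unique)
open import Data.Product using (_×_; ∃; ∃-syntax)
open import Function.Bundles using (_⇔_)
open import Relation.Nullary using (¬_; ¬?)
open import Relation.Binary.PropositionalEquality using (_≡_; _≢_)
open import Level using (0ℓ)

Complex : ℕ → Set₁
Complex n = Subset n → Set

-- A clutter on X: a list of edges, none contained in another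
-- (distinct positions; this also rules out repeated edges).
IsClutter : ∀ {n} → List (Subset n) → Set
IsClutter C = ∀ (i j : Fin (length C)) → i ≢ j → ¬ (lookup C i ⊆ lookup C j)

IsVertexCover : ∀ {n} → List (Subset n) → Subset n → Set
IsVertexCover C D = ∀ S → S ∈ₗ C → Nonempty (S ∩ D)

IsMinimalVertexCover : ∀ {n} → List (Subset n) → Subset n → Set
IsMinimalVertexCover C D =
  IsVertexCover C D × (∀ D' → D' ⊆ D → IsVertexCover C D' → D' ≡ D)

-- Stanley–Reisner complex of the edge ideal I(C): F is a face iff the
-- squarefree monomial x^F is not in I(C), i.e. no generator x^S (S an edge)
-- divides x^F, i.e. no edge S is contained in F.
ΔC : ∀ {n} → List (Subset n) → Complex n
ΔC C F = ¬ (∃[ S ] (S ∈ₗ C × S ⊆ F))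

-- Stanley–Reisner complex of I' = ⋂_{D ∈ Ds, D ∩ A = ∅} (D), where (D) is the
-- ideal generated by the variables of D.  F is a face iff x^F ∉ I';
-- x^F ∈ (D) iff some variable of D divides x^F iff F ∩ D ≠ ∅.
ΔI' : ∀ {n} → List (Subset n) → Subset n → Complex n
ΔI' Ds A F = ¬ (All (λ D → Empty (D ∩ A) → Nonempty (F ∩ D)) Ds)

IsFacet : ∀ {n} → Complex n → Subset n → Set
IsFacet Δ F = Δ F × (∀ G → Δ G → F ⊆ G → G ≡ F)

IsShelling : ∀ {n} → Complex n → List (Subset n) → Set
IsShelling Δ Fs =
  (∀ F → (F ∈ₗ Fs) ⇔ IsFacet Δ F) ×
  Unique Fs ×
  (∀ (i j : Fin (length Fs)) → toℕ i < toℕ j →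
     ∃[ v ] (v ∈ lookup Fs j × v ∉ lookup Fs i ×
       ∃[ ℓ ] (toℕ ℓ < toℕ j × (lookup Fs j ─ lookup Fs ℓ) ≡ ⁅ v ⁆)))

Shellable : ∀ {n} → Complex n → Set
Shellable Δ = ∃[ Fs ] IsShelling Δ Fs

selectDisjoint : ∀ {n} → Subset n → List (Subset n) → List (Subset n)
selectDisjoint A Ds = filter (λ D → ¬? (nonempty? (D ∩ A))) Ds

{-# OPTIONS --safe #-}
module Submission where

-- Since D ∩ A = ∅ iff A ⊆ ∁ D, the complex Δ_{I'} is generated by the facets ∁ Dᵢ of Δ_C
-- that contain A, and as the minimal covers Dᵢ are pairwise incomparable these are
-- exactly its facets.  The shelling restricts to them because its witnesses stay among
-- them: if A ⊆ Hᵢ, A ⊆ Hⱼ and Hⱼ ∖ H_ℓ = {v} with v ∉ Hᵢ, then v ∉ A, so A ⊆ H_ℓ.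

open import Defs
open import Level using (Level)
open import Data.Nat using (ℕ; _<_; z<s; s<s; s<s⁻¹)
open import Data.Fin using (Fin; zero; suc; toℕ)
open import Data.Fin.Subset using (Subset; ∁; _∈_; _∉_; _⊆_; _∩_; _─_; ⁅_⁆; Empty)
open import Data.Fin.Subset.Properties
  using (_∈?_; _⊆?_; nonempty?; ⊆-refl; ⊆-trans; ⊆-antisym; x∈p∩q⁺; x∈p∩q⁻; x∈⁅y⁆⇒x≡y;
         x∈p∧x∉q⇒x∈p─q; x∈∁p⇒x∉p; x∉p⇒x∈∁p; ∁p⊆∁q⇒p⊇q)
open import Data.List using (List; []; _∷_; map; filter; length; lookup)
open import Data.List.Membership.Propositional using (find) renaming (_∈_ to _∈ₗ_)
open import Data.List.Membership.Propositional.Properties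
  using (∈-map⁺; ∈-map⁻; ∈-filter⁺; ∈-filter⁻; ∈-lookup)
import Data.List.Relation.Unary.All as All
open import Data.List.Relation.Unary.All.Properties using (¬All⇒Any¬)
open import Data.List.Relation.Unary.Unique.Propositional using (Unique)
import Data.List.Relation.Unary.Unique.Propositional.Properties as Unique
open import Data.Product using (_×_; ∃-syntax; _,_; proj₁; proj₂)
open import Data.Empty using (⊥-elim)
open import Function using (_∘_)
open import Function.Bundles using (_⇔_; mk⇔; Equivalence)
import Function.Properties.Equivalence as ⇔
open import Relation.Nullary using (¬?; yes; no)
open import Relation.Nullary.Decidable using (_→-dec_)
open import Relation.Unary using (Pred; Decidable)
open import Relation.Binary.PropositionalEquality using (_≡_; refl; sym; trans; cong; cong₂; subst)

private
  variable
    ℓ : Level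
    n : ℕ
    p q : Subset n

∁-injective : ∁ p ≡ ∁ q → p ≡ q
∁-injective ∁p≡∁q =
  ⊆-antisym (∁p⊆∁q⇒p⊇q (subst (∁ _ ⊆_) (sym ∁p≡∁q) ⊆-refl))
            (∁p⊆∁q⇒p⊇q (subst (∁ _ ⊆_) ∁p≡∁q ⊆-refl))

⊆∁⇒disjoint : p ⊆ ∁ q → Empty (p ∩ q)
⊆∁⇒disjoint {p = p} {q} p⊆∁q (x , x∈p∩q) =
  let x∈p , x∈q = x∈p∩q⁻ p q x∈p∩q in x∈∁p⇒x∉p (p⊆∁q x∈p) x∈q

disjoint⇒⊆∁ : Empty (p ∩ q) → p ⊆ ∁ q
disjoint⇒⊆∁ p∩q-empty {x} x∈p = x∉p⇒x∈∁p (λ x∈q → p∩q-empty (x , x∈p∩q⁺ (x∈p , x∈q)))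

⊆∁-swap : p ⊆ ∁ q → q ⊆ ∁ p
⊆∁-swap p⊆∁q x∈q = x∉p⇒x∈∁p (λ x∈p → x∈∁p⇒x∉p (p⊆∁q x∈p) x∈q)

Antichain : List (Subset n) → Set
Antichain Fs = ∀ {F G} → F ∈ₗ Fs → G ∈ₗ Fs → F ⊆ G → F ≡ G

minimalVertexCovers-antichain : ∀ {C Ds : List (Subset n)} →
  (∀ D → (D ∈ₗ Ds) ⇔ IsMinimalVertexCover C D) → Antichain Ds
minimalVertexCovers-antichain mvc {D} {D'} D∈ D'∈ D⊆D' =
  proj₂ (Equivalence.to (mvc D') D'∈) D D⊆D' (proj₁ (Equivalence.to (mvc D) D∈))

antichain-map∁ : ∀ {Ds : List (Subset n)} → Antichain Ds → Antichain (map ∁ Ds)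
antichain-map∁ anti F∈ G∈ F⊆G with ∈-map⁻ ∁ F∈ | ∈-map⁻ ∁ G∈
... | D , D∈ , refl | D' , D'∈ , refl = cong ∁ (sym (anti D'∈ D∈ (∁p⊆∁q⇒p⊇q F⊆G)))

antichain-filter : ∀ {Fs : List (Subset n)} {Q : Pred (Subset n) ℓ} (Q? : Decidable Q) →
  Antichain Fs → Antichain (filter Q? Fs)
antichain-filter Q? anti F∈ G∈ =
  anti (proj₁ (∈-filter⁻ Q? F∈)) (proj₁ (∈-filter⁻ Q? G∈))

generatedBy : List (Subset n) → Complex n
generatedBy Fs G = ∃[ F ] (F ∈ₗ Fs × G ⊆ F)

∈⇔isFacet-generatedBy : ∀ {Fs : List (Subset n)} → Antichain Fs →
  ∀ F → (F ∈ₗ Fs) ⇔ IsFacet (generatedBy Fs) F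
∈⇔isFacet-generatedBy {Fs = Fs} anti F = mk⇔ to from
  where
  to : F ∈ₗ Fs → IsFacet (generatedBy Fs) F
  to F∈ = (F , F∈ , ⊆-refl) , maximal
    where
    maximal : ∀ G → generatedBy Fs G → F ⊆ G → G ≡ F
    maximal G (H , H∈ , G⊆H) F⊆G = ⊆-antisym G⊆F F⊆G
      where
      G⊆F : G ⊆ F
      G⊆F = subst (G ⊆_) (sym (anti F∈ H∈ (⊆-trans F⊆G G⊆H))) G⊆H

  from : IsFacet (generatedBy Fs) F → F ∈ₗ Fs
  from ((H , H∈ , F⊆H) , maximal) = subst (_∈ₗ Fs) (maximal H (H , H∈ , ⊆-refl) F⊆H) H∈

isFacet-cong : ∀ {Δ Δ' : Complex n} → (∀ G → Δ G ⇔ Δ' G) → ∀ F → IsFacet Δ F ⇔ IsFacet Δ' F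
isFacet-cong Δ⇔Δ' F = mk⇔ (transport Δ⇔Δ') (transport (⇔.sym ∘ Δ⇔Δ'))
  where
  transport : ∀ {Γ Γ' : Complex _} → (∀ G → Γ G ⇔ Γ' G) → IsFacet Γ F → IsFacet Γ' F
  transport Γ⇔Γ' (ΓF , maximal) =
    Equivalence.to (Γ⇔Γ' F) ΓF ,
    λ G Γ'G F⊆G → maximal G (Equivalence.from (Γ⇔Γ' G) Γ'G) F⊆G

ΔI'⇔generatedBy : ∀ (Ds : List (Subset n)) A G →
  ΔI' Ds A G ⇔ generatedBy (filter (A ⊆?_) (map ∁ Ds)) G
ΔI'⇔generatedBy Ds A G = mk⇔ to from
  where
  to : ΔI' Ds A G → generatedBy (filter (A ⊆?_) (map ∁ Ds)) G
  to not-all with find (¬All⇒Any¬ (λ D → ¬? (nonempty? (D ∩ A)) →-dec nonempty? (G ∩ D)) Ds not-all)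
  ... | D , D∈ , not-met =
    ∁ D , ∈-filter⁺ (A ⊆?_) (∈-map⁺ ∁ D∈) (⊆∁-swap (disjoint⇒⊆∁ D∩A-empty)) ,
    disjoint⇒⊆∁ (λ G∩D-nonempty → not-met (λ _ → G∩D-nonempty))
    where
    D∩A-empty : Empty (D ∩ A)
    D∩A-empty D∩A-nonempty = not-met (λ disjoint → ⊥-elim (disjoint D∩A-nonempty))

  from : generatedBy (filter (A ⊆?_) (map ∁ Ds)) G → ΔI' Ds A G
  from (F , F∈ , G⊆F) all with ∈-filter⁻ (A ⊆?_) F∈
  ... | F∈∁Ds , A⊆F with ∈-map⁻ ∁ F∈∁Ds
  ...   | D , D∈ , refl =
    ⊆∁⇒disjoint G⊆F (All.lookup all D∈ (⊆∁⇒disjoint (⊆∁-swap A⊆F)))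

map∁-selectDisjoint : ∀ A (Ds : List (Subset n)) →
  map ∁ (selectDisjoint A Ds) ≡ filter (A ⊆?_) (map ∁ Ds)
map∁-selectDisjoint A [] = refl
map∁-selectDisjoint A (D ∷ Ds) with nonempty? (D ∩ A) | A ⊆? ∁ D
... | yes D∩A-nonempty | yes A⊆∁D  = ⊥-elim (⊆∁⇒disjoint (⊆∁-swap A⊆∁D) D∩A-nonempty)
... | yes _            | no _      = map∁-selectDisjoint A Ds
... | no _             | yes _     = cong (∁ D ∷_) (map∁-selectDisjoint A Ds)
... | no D∩A-empty     | no A⊈∁D   = ⊥-elim (A⊈∁D (⊆∁-swap (disjoint⇒⊆∁ D∩A-empty)))

module _ {a} {A : Set a} {P : Pred A ℓ} (P? : Decidable P) where

  filterIndex : ∀ xs → Fin (length (filter P? xs)) → Fin (length xs)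
  filterIndex (x ∷ xs) i with P? x
  filterIndex (x ∷ xs) zero    | yes _ = zero
  filterIndex (x ∷ xs) (suc i) | yes _ = suc (filterIndex xs i)
  filterIndex (x ∷ xs) i       | no _  = suc (filterIndex xs i)

  lookup-filterIndex : ∀ xs i → lookup (filter P? xs) i ≡ lookup xs (filterIndex xs i)
  lookup-filterIndex (x ∷ xs) i with P? x
  lookup-filterIndex (x ∷ xs) zero    | yes _ = refl
  lookup-filterIndex (x ∷ xs) (suc i) | yes _ = lookup-filterIndex xs i
  lookup-filterIndex (x ∷ xs) i       | no _  = lookup-filterIndex xs i

  filterIndex-mono-< : ∀ xs i j → toℕ i < toℕ j → toℕ (filterIndex xs i) < toℕ (filterIndex xs j)
  filterIndex-mono-< (x ∷ xs) i j i<j with P? x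
  filterIndex-mono-< (x ∷ xs) zero    (suc j) i<j | yes _ = z<s
  filterIndex-mono-< (x ∷ xs) (suc i) (suc j) i<j | yes _ = s<s (filterIndex-mono-< xs i j (s<s⁻¹ i<j))
  filterIndex-mono-< (x ∷ xs) i       j       i<j | no _  = s<s (filterIndex-mono-< xs i j i<j)

  filterIndex-cancel-< : ∀ xs i j → toℕ (filterIndex xs i) < toℕ (filterIndex xs j) → toℕ i < toℕ j
  filterIndex-cancel-< (x ∷ xs) i j i<j with P? x
  filterIndex-cancel-< (x ∷ xs) zero    zero    ()  | yes _
  filterIndex-cancel-< (x ∷ xs) zero    (suc j) i<j | yes _ = z<s
  filterIndex-cancel-< (x ∷ xs) (suc i) zero    ()  | yes _
  filterIndex-cancel-< (x ∷ xs) (suc i) (suc j) i<j | yes _ = s<s (filterIndex-cancel-< xs i j (s<s⁻¹ i<j))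
  filterIndex-cancel-< (x ∷ xs) i       j       i<j | no _  = filterIndex-cancel-< xs i j (s<s⁻¹ i<j)

  filterIndex-preimage : ∀ xs k → P (lookup xs k) → ∃[ i ] (filterIndex xs i ≡ k)
  filterIndex-preimage (x ∷ xs) k Pxₖ with P? x
  filterIndex-preimage (x ∷ xs) zero    Px  | yes _ = zero , refl
  filterIndex-preimage (x ∷ xs) (suc k) Pxₖ | yes _ =
    let i , i↦k = filterIndex-preimage xs k Pxₖ in suc i , cong suc i↦k
  filterIndex-preimage (x ∷ xs) zero    Px  | no ¬Px = ⊥-elim (¬Px Px)
  filterIndex-preimage (x ∷ xs) (suc k) Pxₖ | no _ =
    let i , i↦k = filterIndex-preimage xs k Pxₖ in i , cong suc i↦k

  filterIndex-satisfies : ∀ xs i → P (lookup xs (filterIndex xs i))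
  filterIndex-satisfies xs i =
    subst P (lookup-filterIndex xs i) (proj₂ (∈-filter⁻ P? {xs = xs} (∈-lookup i)))

IsShellingOrder : List (Subset n) → Set
IsShellingOrder Fs =
  ∀ (i j : Fin (length Fs)) → toℕ i < toℕ j →
    ∃[ v ] (v ∈ lookup Fs j × v ∉ lookup Fs i ×
      ∃[ ℓ ] (toℕ ℓ < toℕ j × (lookup Fs j ─ lookup Fs ℓ) ≡ ⁅ v ⁆))

ShellingClosed : Pred (Subset n) ℓ → Set ℓ
ShellingClosed Q = ∀ {F G H v} → Q F → Q G → v ∉ F → (G ─ H) ≡ ⁅ v ⁆ → Q H

filter-isShellingOrder : ∀ {Fs : List (Subset n)} {Q : Pred (Subset n) ℓ} (Q? : Decidable Q) →
  ShellingClosed Q → IsShellingOrder Fs → IsShellingOrder (filter Q? Fs)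
filter-isShellingOrder {Fs = Fs} Q? closed order i j i<j
  with order (filterIndex Q? Fs i) (filterIndex Q? Fs j) (filterIndex-mono-< Q? Fs i j i<j)
... | v , v∈Fⱼ , v∉Fᵢ , k , k<j , Fⱼ─Fₖ≡v
  with filterIndex-preimage Q? Fs k
         (closed (filterIndex-satisfies Q? Fs i) (filterIndex-satisfies Q? Fs j) v∉Fᵢ Fⱼ─Fₖ≡v)
...   | ℓ , refl =
  v , subst (v ∈_) (sym (at j)) v∈Fⱼ , subst (v ∉_) (sym (at i)) v∉Fᵢ ,
  ℓ , filterIndex-cancel-< Q? Fs ℓ j k<j , trans (cong₂ _─_ (at j) (at ℓ)) Fⱼ─Fₖ≡v
  where
  at : ∀ i → lookup (filter Q? Fs) i ≡ lookup Fs (filterIndex Q? Fs i)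
  at = lookup-filterIndex Q? Fs

⊇-shellingClosed : ∀ {A : Subset n} → ShellingClosed (A ⊆_)
⊇-shellingClosed {F = F} {H = H} {v = v} A⊆F A⊆G v∉F G─H≡v {a} a∈A with a ∈? H
... | yes a∈H = a∈H
... | no a∉H = ⊥-elim (v∉F (subst (_∈ F) a≡v (A⊆F a∈A)))
  where
  a≡v : a ≡ v
  a≡v = x∈⁅y⁆⇒x≡y v (subst (a ∈_) G─H≡v (x∈p∧x∉q⇒x∈p─q (A⊆G a∈A) a∉H))

lemma5p1 : ∀ (n : ℕ) (C : List (Subset n)) (Ds : List (Subset n)) (A : Subset n) →
    IsClutter C →
    Unique Ds →
    (∀ D → (D ∈ₗ Ds) ⇔ IsMinimalVertexCover C D) →
    IsShelling (ΔC C) (map ∁ Ds) →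
    Shellable (ΔI' Ds A) × IsShelling (ΔI' Ds A) (map ∁ (selectDisjoint A Ds))
lemma5p1 n C Ds A _ unique mvc (_ , _ , order) = (_ , shelling) , shelling
  where
  facetsContainingA : List (Subset n)
  facetsContainingA = filter (A ⊆?_) (map ∁ Ds)

  antichain : Antichain facetsContainingA
  antichain = antichain-filter (A ⊆?_) (antichain-map∁ (minimalVertexCovers-antichain mvc))

  facets : ∀ F → (F ∈ₗ facetsContainingA) ⇔ IsFacet (ΔI' Ds A) F
  facets F = ⇔.trans (∈⇔isFacet-generatedBy antichain F)
                     (isFacet-cong (⇔.sym ∘ ΔI'⇔generatedBy Ds A) F)

  shelling : IsShelling (ΔI' Ds A) (map ∁ (selectDisjoint A Ds))
  shelling = subst (IsShelling (ΔI' Ds A)) (sym (map∁-selectDisjoint A Ds))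
    ( facets
    , Unique.filter⁺ (A ⊆?_) (Unique.map⁺ ∁-injective unique)
    , filter-isShellingOrder {Fs = map ∁ Ds} (A ⊆?_) ⊇-shellingClosed order )
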